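{- The modal logic $\Re_d$ is decidable: there is an algorithm that, given a formula $\phi$ of $\mathcal L$, decides whether $\vdash_{\Re_d}\phi$.
   Context: The language $\mathcal L$: formulas built from propositional variables and $\bot$ using $\rightarrow$ and a binary modality $\rhd$; $\wedge,\vee,\neg,\top$ defined as usual. The logic $\Re_d$: classical propositional logic in $\mathcal L$ plus axioms A1: $\phi\rhd\psi\rightarrow(\chi\rhd\psi\rightarrow(\phi\vee\chi)\rhd\psi)$, A2: $\bot\rhd\phi$, A3: $\phi\rhd\top$, A4: $\phi\rhd\psi\rightarrow(\phi\rhd\chi\rightarrow\phi\rhd(\psi\wedge\chi))$, with inference rules Modus Ponens and M: from $\phi_1\rightarrow\phi_2$ and $\psi_1\rightarrow\psi_2$ infer $\phi_2\rhd\psi_1\rightarrow\phi_1\rhd\psi_2$. -}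

module Defs where

open import Data.Nat using (ℕ)
open import Data.Bool using (Bool; true; false; not; _∨_)
open import Relation.Binary.PropositionalEquality using (_≡_)

infixr 5 _⇒_
infix 7 _▷_
data Fm : Set where
  var : ℕ → Fm
  ⊥'  : Fm
  _⇒_ : Fm → Fm → Fm
  _▷_ : Fm → Fm → Fm

¬' : Fm → Fm
¬' φ = φ ⇒ ⊥'

⊤' : Fm
⊤' = ¬' ⊥'

_∨'_ : Fm → Fm → Fm
φ ∨' ψ = ¬' φ ⇒ ψ

_∧'_ : Fm → Fm → Fm
φ ∧' ψ = ¬' (φ ⇒ ¬' ψ)

eval : (Fm → Bool) → Fm → Bool
eval v (var p) = v (var p)
eval v ⊥' = false
eval v (φ ⇒ ψ) = not (eval v φ) ∨ eval v ψ
eval v (φ ▷ ψ) = v (φ ▷ ψ)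

Tautology : Fm → Set
Tautology φ = ∀ (v : Fm → Bool) → eval v φ ≡ true

data ⊢_ : Fm → Set where
  taut : ∀ {φ} → Tautology φ → ⊢ φ
  A1   : ∀ φ ψ χ → ⊢ (φ ▷ ψ ⇒ (χ ▷ ψ ⇒ (φ ∨' χ) ▷ ψ))
  A2   : ∀ φ → ⊢ (⊥' ▷ φ)
  A3   : ∀ φ → ⊢ (φ ▷ ⊤')
  A4   : ∀ φ ψ χ → ⊢ (φ ▷ ψ ⇒ (φ ▷ χ ⇒ φ ▷ (ψ ∧' χ)))
  MP   : ∀ {φ ψ} → ⊢ (φ ⇒ ψ) → ⊢ φ → ⊢ ψ
  M    : ∀ {φ₁ φ₂ ψ₁ ψ₂} → ⊢ (φ₁ ⇒ φ₂) → ⊢ (ψ₁ ⇒ ψ₂) → ⊢ (φ₂ ▷ ψ₁ ⇒ φ₁ ▷ ψ₂)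

{-# OPTIONS --safe #-}
-- The semantics: finite models whose worlds carry a valuation of the variables and a list of
-- pairs (u , x), where φ ▷ ψ holds if every pair with u ⊩ φ has x ⊩ ψ.  All axioms and rules
-- are sound for it, and completeness is proved together with decidability, by induction on
-- the modal depth of φ.  Treat the variables and outermost ▷-formulas of φ as propositional
-- atoms and take a valuation v of them falsifying φ, with P the ▷-atoms true in v.  For a
-- ▷-atom c ▷ d false in v, the theorem (c ∧ ¬a) ▷ d → (c ∧ a) ▷ (b → d) → a ▷ b → c ▷ d
-- (from M, A1, A4) lets us split c along every a ▷ b in P, which reduces ⊢ ⋀P → c ▷ d to
-- 2^|P| questions ⊢ ¬c' or ⊢ d' about formulas of smaller depth, closed by A2 or A3.  If one
-- such implication is derived, it is a theorem false in v.  Otherwise each failed branch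
-- yields countermodels u ⊩ c' and x ⊮ d' respecting P, and one world whose pairs are these
-- (u , x) realises v and refutes φ.  If no valuation gives a countermodel, φ follows
-- propositionally from the theorems found.
module Submission where

open import Defs
open import Data.Bool using (Bool; true; false; T; not; _∨_)
open import Data.Empty using (⊥; ⊥-elim)
open import Data.List using (List; []; _∷_; _++_; map; foldr; filter)
open import Data.List.Membership.Propositional using (_∈_; find)
open import Data.List.Membership.Propositional.Properties
  using (∈-++⁺ˡ; ∈-++⁺ʳ; ∈-++⁻; ∈-map⁺; ∈-filter⁺; ∈-filter⁻)
open import Data.List.Relation.Unary.All as All using (All; []; _∷_)
import Data.List.Relation.Unary.All.Properties as AllP
open import Data.List.Relation.Unary.Any as Any using (Any; here; there)
import Data.List.Relation.Unary.Any.Properties as AnyP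
open import Data.Nat using (ℕ; zero; suc; _≤_; _<_; _⊔_; z≤n; s≤s)
import Data.Nat.Properties as ℕ
open import Data.Product using (Σ-syntax; _×_; _,_; proj₁; proj₂; uncurry)
open import Data.Sum as Sum using (_⊎_; inj₁; inj₂; [_,_]′)
open import Function using (_∘_; id)
open import Relation.Binary.Definitions using (DecidableEquality)
open import Relation.Binary.PropositionalEquality using (_≡_; refl; sym; trans; cong; cong₂; subst)
open import Relation.Nullary using (¬_; Dec; yes; no; does; proof; _because_; Stable; contradiction)
open import Relation.Nullary.Decidable
  using (T?; ¬?; _→-dec_; _×-dec_; map′; toSum; decidable-stable)
open import Relation.Nullary.Reflects
  using (Reflects; ofʸ; ofⁿ; invert; T-reflects; _→-reflects_; det; fromEquivalence)

reflects-true : ∀ {A : Set} {b} → Reflects A b → b ≡ true → A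
reflects-true r refl = invert r

reflects-false : ∀ {A : Set} {b} → Reflects A b → b ≡ false → ¬ A
reflects-false r refl = invert r

infix 4 _⊨_ _⊩_ _⊩?_

_⊨_ : (Fm → Bool) → Fm → Set
v ⊨ var p = T (v (var p))
v ⊨ ⊥' = ⊥
v ⊨ φ ⇒ ψ = v ⊨ φ → v ⊨ ψ
v ⊨ φ ▷ ψ = T (v (φ ▷ ψ))

⊨-reflects : ∀ v φ → Reflects (v ⊨ φ) (eval v φ)
⊨-reflects v (var p) = T-reflects (v (var p))
⊨-reflects v ⊥' = ofⁿ id
⊨-reflects v (φ ⇒ ψ) = ⊨-reflects v φ →-reflects ⊨-reflects v ψ
⊨-reflects v (φ ▷ ψ) = T-reflects (v (φ ▷ ψ))

⊨-stable : ∀ v φ → Stable (v ⊨ φ)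
⊨-stable v φ = decidable-stable (eval v φ because ⊨-reflects v φ)

imps : List Fm → Fm → Fm
imps Γ φ = foldr _⇒_ φ Γ

⊨-imps⁺ : ∀ {v} Γ {φ} → (All (v ⊨_) Γ → v ⊨ φ) → v ⊨ imps Γ φ
⊨-imps⁺ [] h = h []
⊨-imps⁺ (γ ∷ Γ) h vγ = ⊨-imps⁺ Γ (h ∘ (vγ ∷_))

⊨-imps⁻ : ∀ {v} Γ {φ} → v ⊨ imps Γ φ → All (v ⊨_) Γ → v ⊨ φ
⊨-imps⁻ [] h [] = h
⊨-imps⁻ (γ ∷ Γ) h (vγ ∷ vΓ) = ⊨-imps⁻ Γ (h vγ) vΓ

⊢-imps⁻ : ∀ Γ {φ} → ⊢ imps Γ φ → All ⊢_ Γ → ⊢ φ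
⊢-imps⁻ [] d [] = d
⊢-imps⁻ (γ ∷ Γ) d (dγ ∷ dΓ) = ⊢-imps⁻ Γ (MP d dγ) dΓ

⊢-consequence : ∀ {Γ φ} → All ⊢_ Γ → (∀ v → All (v ⊨_) Γ → v ⊨ φ) → ⊢ φ
⊢-consequence {Γ} {φ} ⊢Γ h =
  ⊢-imps⁻ Γ (taut λ v → det (⊨-reflects v (imps Γ φ)) (ofʸ (⊨-imps⁺ Γ (h v)))) ⊢Γ

⊢-tautology : ∀ {φ} → (∀ v → v ⊨ φ) → ⊢ φ
⊢-tautology h = ⊢-consequence [] λ v _ → h v

▷-antitoneˡ : ∀ {φ₁ φ₂ ψ} → ⊢ (φ₁ ⇒ φ₂) → ⊢ (φ₂ ▷ ψ ⇒ φ₁ ▷ ψ)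
▷-antitoneˡ d = M d (⊢-tautology λ _ → id)

▷-monotoneʳ : ∀ {φ ψ₁ ψ₂} → ⊢ (ψ₁ ⇒ ψ₂) → ⊢ (φ ▷ ψ₁ ⇒ φ ▷ ψ₂)
▷-monotoneʳ d = M (⊢-tautology λ _ → id) d

▷-split : ∀ a b c d → ⊢ ((c ∧' ¬' a) ▷ d ⇒ (c ∧' a) ▷ (b ⇒ d) ⇒ a ▷ b ⇒ c ▷ d)
▷-split a b c d =
  ⊢-consequence (narrow ∷ A4 (c ∧' a) b (b ⇒ d) ∷ detach ∷ A1 (c ∧' a) d (c ∧' ¬' a) ∷ cover ∷ [])
    λ { _ (s₁ ∷ s₂ ∷ s₃ ∷ s₄ ∷ s₅ ∷ []) ¬a-case a-case a▷b →
          s₅ (s₄ (s₃ (s₂ (s₁ a▷b) a-case)) ¬a-case) }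
  where
  narrow : ⊢ (a ▷ b ⇒ (c ∧' a) ▷ b)
  narrow = ▷-antitoneˡ (⊢-tautology λ v c∧a → ⊨-stable v a λ ¬a → c∧a λ _ → ¬a)
  detach : ⊢ ((c ∧' a) ▷ (b ∧' (b ⇒ d)) ⇒ (c ∧' a) ▷ d)
  detach = ▷-monotoneʳ (⊢-tautology λ v h → ⊨-stable v d λ ¬d → h λ hb b⇒d → ¬d (b⇒d hb))
  cover : ⊢ (((c ∧' a) ∨' (c ∧' ¬' a)) ▷ d ⇒ c ▷ d)
  cover = ▷-antitoneˡ (⊢-tautology λ v hc ¬c∧a c∧¬a → ¬c∧a λ c→¬a → c∧¬a hc (c→¬a hc))

arrow : Fm × Fm → Fm
arrow (a , b) = a ▷ b

Split : List (Fm × Fm) → Fm × Fm → Set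
Split [] (c , d) = ⊢ ¬' c ⊎ ⊢ d
Split ((a , b) ∷ P) (c , d) = Split P (c ∧' ¬' a , d) × Split P (c ∧' a , b ⇒ d)

split-sound : ∀ P {c d} → Split P (c , d) → ⊢ imps (map arrow P) (c ▷ d)
split-sound [] (inj₁ ⊢¬c) = MP (▷-antitoneˡ ⊢¬c) (A2 _)
split-sound [] {d = d} (inj₂ ⊢d) = MP (▷-monotoneʳ ⊤⇒d) (A3 _)
  where
  ⊤⇒d : ⊢ (⊤' ⇒ d)
  ⊤⇒d = ⊢-consequence (⊢d ∷ []) λ { _ (hd ∷ []) _ → hd }
split-sound ((a , b) ∷ P) {c} {d} (s₁ , s₂) =
  ⊢-consequence (▷-split a b c d ∷ split-sound P s₁ ∷ split-sound P s₂ ∷ [])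
    λ { _ (split ∷ h₁ ∷ h₂ ∷ []) a▷b → ⊨-imps⁺ (map arrow P) λ hP →
          split (⊨-imps⁻ (map arrow P) h₁ hP) (⊨-imps⁻ (map arrow P) h₂ hP) a▷b }

data World : Set where
  node : (ℕ → Bool) → List (World × World) → World

-- ⊥' and ⇒ are matched first so that they compute for a variable world.
_⊩_ : World → Fm → Set
w ⊩ ⊥' = ⊥
w ⊩ φ ⇒ ψ = w ⊩ φ → w ⊩ ψ
node V R ⊩ var p = T (V p)
node V R ⊩ φ ▷ ψ = All (λ (u , x) → u ⊩ φ → x ⊩ ψ) R

_⊩?_ : ∀ w φ → Dec (w ⊩ φ)
w ⊩? ⊥' = no id
w ⊩? φ ⇒ ψ = w ⊩? φ →-dec w ⊩? ψ
node V R ⊩? var p = T? (V p)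
node V R ⊩? φ ▷ ψ = All.all? (λ (u , x) → u ⊩? φ →-dec x ⊩? ψ) R

⊩-stable : ∀ w φ → Stable (w ⊩ φ)
⊩-stable w φ = decidable-stable (w ⊩? φ)

valuation : World → Fm → Bool
valuation w x = does (w ⊩? x)

⊩-reflects : ∀ w φ → Reflects (w ⊩ φ) (eval (valuation w) φ)
⊩-reflects w (var p) = proof (w ⊩? var p)
⊩-reflects w ⊥' = ofⁿ id
⊩-reflects w (φ ⇒ ψ) = ⊩-reflects w φ →-reflects ⊩-reflects w ψ
⊩-reflects w (φ ▷ ψ) = proof (w ⊩? φ ▷ ψ)

sound : ∀ {φ} → ⊢ φ → ∀ w → w ⊩ φ
sound {φ} (taut t) w = reflects-true (⊩-reflects w φ) (t (valuation w))
sound (A1 φ ψ χ) (node V R) h₁ h₂ =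
  All.zipWith (λ { {u , _} (f , g) φ∨χ → [ f , g ∘ φ∨χ ]′ (toSum (u ⊩? φ)) }) (h₁ , h₂)
sound (A2 φ) (node V R) = All.universal (λ _ ()) R
sound (A3 φ) (node V R) = All.universal (λ _ _ → id) R
sound (A4 φ ψ χ) (node V R) h₁ h₂ =
  All.zipWith (λ (f , g) hφ both → both (f hφ) (g hφ)) (h₁ , h₂)
sound (MP d e) w = sound d w (sound e w)
sound (M d e) (node V R) = All.map λ { {u , x} f h → sound e x (f (sound d u h)) }

Countermodel : Fm → Set
Countermodel φ = Σ[ w ∈ World ] ¬ w ⊩ φ

record CounterPair (P : List (Fm × Fm)) (cd : Fm × Fm) : Set where
  field
    source target : World
    source⊩c : source ⊩ proj₁ cd
    target⊮d : ¬ target ⊩ proj₂ cd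
    respects : All (λ (a , b) → source ⊩ a → target ⊩ b) P

counterPair-∧¬ : ∀ {P a b c d} → CounterPair P (c ∧' ¬' a , d) → CounterPair ((a , b) ∷ P) (c , d)
counterPair-∧¬ {c = c} cp = record
  { source = source
  ; target = target
  ; source⊩c = ⊩-stable source c λ ¬c → source⊩c λ hc _ → ¬c hc
  ; target⊮d = target⊮d
  ; respects = (λ ha → ⊥-elim (source⊩c λ _ ¬a → ¬a ha)) ∷ respects
  }
  where open CounterPair cp

counterPair-∧ : ∀ {P a b c d} → CounterPair P (c ∧' a , b ⇒ d) → CounterPair ((a , b) ∷ P) (c , d)
counterPair-∧ {b = b} {c} cp = record
  { source = source
  ; target = target
  ; source⊩c = ⊩-stable source c λ ¬c → source⊩c λ hc _ → ¬c hc
  ; target⊮d = λ hd → target⊮d λ _ → hd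
  ; respects = (λ _ → ⊩-stable target b λ ¬b → target⊮d λ hb → ⊥-elim (¬b hb)) ∷ respects
  }
  where open CounterPair cp

depth : Fm → ℕ
depth (var _) = 0
depth ⊥' = 0
depth (φ ⇒ ψ) = depth φ ⊔ depth ψ
depth (φ ▷ ψ) = suc (depth φ ⊔ depth ψ)

⇒-depth< : ∀ {m} φ ψ → depth φ < m → depth ψ < m → depth (φ ⇒ ψ) < m
⇒-depth< φ ψ = ℕ.⊔-lub

¬'-depth< : ∀ {m} φ → depth φ < m → depth (¬' φ) < m
¬'-depth< φ h = ⇒-depth< φ ⊥' h (ℕ.≤-<-trans z≤n h)

∧'-depth< : ∀ {m} φ ψ → depth φ < m → depth ψ < m → depth (φ ∧' ψ) < m
∧'-depth< φ ψ h₁ h₂ = ¬'-depth< (φ ⇒ ¬' ψ) (⇒-depth< φ (¬' ψ) h₁ (¬'-depth< ψ h₂))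

Decider : ℕ → Set
Decider m = ∀ ψ → depth ψ < m → ⊢ ψ ⊎ Countermodel ψ

▷-depth≤ : ∀ {m} a b → depth (a ▷ b) ≤ m → depth a < m × depth b < m
▷-depth≤ a b h = ℕ.m⊔n<o⇒m<o (depth a) (depth b) h , ℕ.m⊔n<o⇒n<o (depth a) (depth b) h

split-or-counterPair : ∀ {m} → Decider m → ∀ P c d →
  All (λ ab → depth (arrow ab) ≤ m) P → depth c < m → depth d < m →
  Split P (c , d) ⊎ CounterPair P (c , d)
split-or-counterPair decide [] c d [] c< d< with decide (¬' c) (¬'-depth< c c<) | decide d d<
... | inj₁ ⊢¬c | _ = inj₁ (inj₁ ⊢¬c)
... | inj₂ _ | inj₁ ⊢d = inj₁ (inj₂ ⊢d)
... | inj₂ (p , p⊮¬c) | inj₂ (q , q⊮d) = inj₂ (record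
  { source = p ; target = q ; source⊩c = ⊩-stable p c p⊮¬c ; target⊮d = q⊮d ; respects = [] })
split-or-counterPair {m} decide ((a , b) ∷ P) c d (a▷b≤ ∷ P≤) c< d<
  with split-or-counterPair decide P (c ∧' ¬' a) d P≤ (∧'-depth< c (¬' a) c< (¬'-depth< a a<)) d<
     | split-or-counterPair decide P (c ∧' a) (b ⇒ d) P≤ (∧'-depth< c a c< a<) (⇒-depth< b d b< d<)
  where
  a< : depth a < m
  a< = proj₁ (▷-depth≤ a b a▷b≤)
  b< : depth b < m
  b< = proj₂ (▷-depth≤ a b a▷b≤)
... | inj₁ s₁ | inj₁ s₂ = inj₁ (s₁ , s₂)
... | inj₂ cp | _ = inj₂ (counterPair-∧¬ cp)
... | inj₁ _ | inj₂ cp = inj₂ (counterPair-∧ cp)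

vars : Fm → List ℕ
vars (var p) = p ∷ []
vars ⊥' = []
vars (φ ⇒ ψ) = vars φ ++ vars ψ
vars (_ ▷ _) = []

arrows : Fm → List (Fm × Fm)
arrows (var _) = []
arrows ⊥' = []
arrows (φ ⇒ ψ) = arrows φ ++ arrows ψ
arrows (φ ▷ ψ) = (φ , ψ) ∷ []

atoms : Fm → List Fm
atoms φ = map var (vars φ) ++ map arrow (arrows φ)

eval-cong : ∀ φ {v v'} →
  (∀ {p} → p ∈ vars φ → v (var p) ≡ v' (var p)) →
  (∀ {ab} → ab ∈ arrows φ → v (arrow ab) ≡ v' (arrow ab)) →
  eval v φ ≡ eval v' φ
eval-cong (var p) onVars _ = onVars (here refl)
eval-cong ⊥' _ _ = refl
eval-cong (φ ⇒ ψ) onVars onArrows =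
  cong₂ (λ a b → not a ∨ b)
    (eval-cong φ (onVars ∘ ∈-++⁺ˡ) (onArrows ∘ ∈-++⁺ˡ))
    (eval-cong ψ (onVars ∘ ∈-++⁺ʳ (vars φ)) (onArrows ∘ ∈-++⁺ʳ (arrows φ)))
eval-cong (φ ▷ ψ) _ onArrows = onArrows (here refl)

arrows-depth : ∀ φ {ab} → ab ∈ arrows φ → depth (arrow ab) ≤ depth φ
arrows-depth (φ ⇒ ψ) ab∈ with ∈-++⁻ (arrows φ) ab∈
... | inj₁ ab∈φ = ℕ.≤-trans (arrows-depth φ ab∈φ) (ℕ.m≤m⊔n (depth φ) (depth ψ))
... | inj₂ ab∈ψ = ℕ.≤-trans (arrows-depth ψ ab∈ψ) (ℕ.m≤n⊔m (depth φ) (depth ψ))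
arrows-depth (φ ▷ ψ) (here refl) = ℕ.≤-refl

Agree : List Fm → (Fm → Bool) → (Fm → Bool) → Set
Agree L v v' = ∀ {x} → x ∈ L → v x ≡ v' x

agree-arrows : ∀ φ {v v'} → Agree (atoms φ) v v' →
  ∀ {ab} → ab ∈ arrows φ → v (arrow ab) ≡ v' (arrow ab)
agree-arrows φ agree = agree ∘ ∈-++⁺ʳ (map var (vars φ)) ∘ ∈-map⁺ arrow

eval-agree : ∀ φ {v v'} → Agree (atoms φ) v v' → eval v φ ≡ eval v' φ
eval-agree φ agree = eval-cong φ (agree ∘ ∈-++⁺ˡ ∘ ∈-map⁺ var) (agree-arrows φ agree)

_≟_ : DecidableEquality Fm
var p ≟ var q = map′ (cong var) (λ { refl → refl }) (p ℕ.≟ q)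
⊥' ≟ ⊥' = yes refl
(φ ⇒ ψ) ≟ (φ' ⇒ ψ') = map′ (uncurry (cong₂ _⇒_)) (λ { refl → refl , refl }) (φ ≟ φ' ×-dec ψ ≟ ψ')
(φ ▷ ψ) ≟ (φ' ▷ ψ') = map′ (uncurry (cong₂ _▷_)) (λ { refl → refl , refl }) (φ ≟ φ' ×-dec ψ ≟ ψ')
var _ ≟ ⊥' = no λ ()
var _ ≟ (_ ⇒ _) = no λ ()
var _ ≟ (_ ▷ _) = no λ ()
⊥' ≟ var _ = no λ ()
⊥' ≟ (_ ⇒ _) = no λ ()
⊥' ≟ (_ ▷ _) = no λ ()
(_ ⇒ _) ≟ var _ = no λ ()
(_ ⇒ _) ≟ ⊥' = no λ ()
(_ ⇒ _) ≟ (_ ▷ _) = no λ ()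
(_ ▷ _) ≟ var _ = no λ ()
(_ ▷ _) ≟ ⊥' = no λ ()
(_ ▷ _) ≟ (_ ⇒ _) = no λ ()

update : Fm → Bool → (Fm → Bool) → Fm → Bool
update x b v y with y ≟ x
... | yes _ = b
... | no _ = v y

update-agrees : ∀ {x b L v₀ v} → v x ≡ b → Agree L v₀ v → Agree (x ∷ L) (update x b v₀) v
update-agrees {x} vx≡b agree {y} y∈ with y ≟ x | y∈
... | yes refl | _ = sym vx≡b
... | no y≢x | here y≡x = contradiction y≡x y≢x
... | no _ | there y∈L = agree y∈L

valuations : List Fm → List (Fm → Bool)
valuations [] = (λ _ → false) ∷ []
valuations (x ∷ L) = map (update x true) (valuations L) ++ map (update x false) (valuations L)

valuations-cover : ∀ L v → Any (λ v₀ → Agree L v₀ v) (valuations L)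
valuations-cover [] v = here λ ()
valuations-cover (x ∷ L) v with v x in vx
... | true = AnyP.++⁺ˡ (AnyP.map⁺ (Any.map (update-agrees vx) (valuations-cover L v)))
... | false = AnyP.++⁺ʳ _ (AnyP.map⁺ (Any.map (update-agrees vx) (valuations-cover L v)))

DerivableOn : ((Fm → Bool) → Set) → Fm → Set
DerivableOn S φ = Σ[ Γ ∈ List Fm ] All ⊢_ Γ × (∀ v → S v → All (v ⊨_) Γ → v ⊨ φ)

derivableOn-any : ∀ {A : Set} {S : A → (Fm → Bool) → Set} {φ} xs →
  All (λ x → DerivableOn (S x) φ) xs → DerivableOn (λ v → Any (λ x → S x v) xs) φ
derivableOn-any [] [] = [] , [] , λ _ ()
derivableOn-any {φ = φ} (x ∷ xs) ((Γ , ⊢Γ , h) ∷ ds) with derivableOn-any {φ = φ} xs ds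
... | Δ , ⊢Δ , h' = Γ ++ Δ , AllP.++⁺ ⊢Γ ⊢Δ , λ
  { v (here s) vΓΔ → h v s (AllP.++⁻ˡ Γ vΓΔ)
  ; v (there s) vΓΔ → h' v s (AllP.++⁻ʳ Γ vΓΔ)
  }

⊢-by-cases : ∀ L {φ} → All (λ v₀ → DerivableOn (Agree L v₀) φ) (valuations L) → ⊢ φ
⊢-by-cases L {φ} ds with derivableOn-any {φ = φ} (valuations L) ds
... | Γ , ⊢Γ , h = ⊢-consequence ⊢Γ λ v → h v (valuations-cover L v)

any-or-all : ∀ {A : Set} {P Q : A → Set} xs → (∀ {x} → x ∈ xs → P x ⊎ Q x) → Any P xs ⊎ All Q xs
any-or-all [] _ = inj₂ []
any-or-all (x ∷ xs) f with f (here refl)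
... | inj₁ px = inj₁ (here px)
... | inj₂ qx = Sum.map there (qx ∷_) (any-or-all xs (f ∘ there))

edges : ∀ {P N} → All (CounterPair P) N → List (World × World)
edges = All.reduce λ cp → CounterPair.source cp , CounterPair.target cp

edges-respect : ∀ {P N a b} → (a , b) ∈ P → (cps : All (CounterPair P) N) →
  All (λ (u , x) → u ⊩ a → x ⊩ b) (edges cps)
edges-respect ab∈P [] = []
edges-respect ab∈P (cp ∷ cps) = All.lookup (CounterPair.respects cp) ab∈P ∷ edges-respect ab∈P cps

edges-refute : ∀ {P N c d} → (c , d) ∈ N → (cps : All (CounterPair P) N) →
  ¬ All (λ (u , x) → u ⊩ c → x ⊩ d) (edges cps)
edges-refute (here refl) (cp ∷ _) (h ∷ _) = target⊮d (h source⊩c)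
  where open CounterPair cp
edges-refute (there cd∈N) (_ ∷ cps) (_ ∷ hs) = edges-refute cd∈N cps hs

module _ {m} (decide : Decider m) (φ : Fm) (φ≤m : depth φ ≤ m) where

  arrows-shallow : ∀ {ab} → ab ∈ arrows φ → depth (arrow ab) ≤ m
  arrows-shallow ab∈ = ℕ.≤-trans (arrows-depth φ ab∈) φ≤m

  module _ (v : Fm → Bool) where

    holds? : ∀ ab → Dec (T (v (arrow ab)))
    holds? ab = T? (v (arrow ab))

    positives negatives : List (Fm × Fm)
    positives = filter holds? (arrows φ)
    negatives = filter (¬? ∘ holds?) (arrows φ)

    positives-hold : ∀ {v'} → Agree (atoms φ) v v' → All (v' ⊨_) (map arrow positives)
    positives-hold agree = AllP.map⁺ (All.tabulate λ ab∈ →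
      let ab∈A , holds = ∈-filter⁻ holds? {xs = arrows φ} ab∈
      in subst T (agree-arrows φ agree ab∈A) holds)

    negatives-fail : ∀ {v' cd} → Agree (atoms φ) v v' → cd ∈ negatives → ¬ v' ⊨ arrow cd
    negatives-fail agree cd∈ =
      let cd∈A , fails = ∈-filter⁻ (¬? ∘ holds?) {xs = arrows φ} cd∈
      in fails ∘ subst T (sym (agree-arrows φ agree cd∈A))

    refutation : Any (Split positives) negatives → DerivableOn (Agree (atoms φ) v) φ
    refutation splits with find splits
    ... | (c , d) , cd∈ , split =
      θ ∷ [] , split-sound positives split ∷ [] ,
      λ { v' agree (v'⊨θ ∷ []) → ⊥-elim (θ-fails agree v'⊨θ) }
      where
      θ : Fm
      θ = imps (map arrow positives) (c ▷ d)
      θ-fails : ∀ {v'} → Agree (atoms φ) v v' → ¬ v' ⊨ θ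
      θ-fails agree v'⊨θ =
        negatives-fail agree cd∈ (⊨-imps⁻ (map arrow positives) v'⊨θ (positives-hold agree))

    countermodel : eval v φ ≡ false → All (CounterPair positives) negatives → Countermodel φ
    countermodel v⊭φ cps = root , reflects-false (⊩-reflects root φ) (trans root≈v v⊭φ)
      where
      root : World
      root = node (λ p → v (var p)) (edges cps)
      root-arrows : ∀ {ab} → ab ∈ arrows φ → valuation root (arrow ab) ≡ v (arrow ab)
      root-arrows {ab} ab∈ = det (proof (root ⊩? arrow ab)) (fromEquivalence positive negative)
        where
        positive : T (v (arrow ab)) → root ⊩ arrow ab
        positive holds = edges-respect (∈-filter⁺ holds? ab∈ holds) cps
        negative : root ⊩ arrow ab → T (v (arrow ab))
        negative root⊩ab = decidable-stable (holds? ab) λ fails →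
          edges-refute (∈-filter⁺ (¬? ∘ holds?) ab∈ fails) cps root⊩ab
      root≈v : eval (valuation root) φ ≡ eval v φ
      root≈v = eval-cong φ (λ _ → refl) root-arrows

    positives-shallow : All (λ ab → depth (arrow ab) ≤ m) positives
    positives-shallow = All.tabulate (arrows-shallow ∘ proj₁ ∘ ∈-filter⁻ holds? {xs = arrows φ})

    split-or-counterPair-at : ∀ {cd} → cd ∈ negatives → Split positives cd ⊎ CounterPair positives cd
    split-or-counterPair-at {c , d} cd∈ =
      let cd∈A = proj₁ (∈-filter⁻ (¬? ∘ holds?) {xs = arrows φ} cd∈)
          c< , d< = ▷-depth≤ c d (arrows-shallow cd∈A)
      in split-or-counterPair decide positives c d positives-shallow c< d<

    settle : DerivableOn (Agree (atoms φ) v) φ ⊎ Countermodel φ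
    settle with eval v φ in v[φ]
    ... | true = inj₁ ([] , [] , λ v' agree _ →
      reflects-true (⊨-reflects v' φ) (trans (sym (eval-agree φ agree)) v[φ]))
    ... | false =
      Sum.map refutation (countermodel v[φ]) (any-or-all negatives split-or-counterPair-at)

  decide-step : ⊢ φ ⊎ Countermodel φ
  decide-step with All.decide settle (valuations (atoms φ))
  ... | inj₁ derivable = inj₁ (⊢-by-cases (atoms φ) derivable)
  ... | inj₂ refuted = inj₂ (proj₂ (Any.satisfied refuted))

decider : ∀ m → Decider m
decider zero _ ()
decider (suc m) ψ (s≤s ψ≤m) = decide-step (decider m) ψ ψ≤m

corollary2 : (φ : Fm) → Dec (⊢ φ)
corollary2 φ with decider (suc (depth φ)) φ ℕ.≤-refl
... | inj₁ ⊢φ = yes ⊢φ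
... | inj₂ (w , w⊮φ) = no λ ⊢φ → w⊮φ (sound ⊢φ w)
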